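{- Let $p_1,p_2,q_1,q_2$ be pairwise distinct primes and let $M,N,y_\alpha,z_\alpha$ be as in the context. Then: (1) if $\alpha<\omega$ and $r,s\in\mathbb{Z}[1/p_2]$ satisfy $ry_\alpha+sz_\alpha\in p_1^\omega N$, then $r=s=0$; (2) $p_1^\omega M=M$, $p_2^\omega N=N$, and $p_1^\omega N=M$; (3) $M,N\in K_1$ and $M\leq_{\mathbf{K}_1}N$.
   Context: For a prime $p$ and group $G$, $p^\omega G:=\bigcap_{n<\omega}p^nG$; $\leq_p$ denotes pure subgroup. $K_1$ is the class of torsion-free abelian groups $G$ with $|p_1^\omega G|,|p_2^\omega G|\le\aleph_0$, and for $G_1,G_2\in K_1$, $G_1\leq_{\mathbf{K}_1}G_2$ iff $G_1\leq_pG_2$, $p_1^\omega G_1=p_1^\omega G_2$, and either $G_1=p_1^\omega G_1$ or $p_2^\omega G_1=p_2^\omega G_2$. $U:=\prod_{\alpha<\omega}\mathbb{Q}e_\alpha$, $M:=\bigoplus_{\alpha<\omega}\mathbb{Z}[1/p_1,1/p_2]e_\alpha\le U$ (with $\mathbb{Z}[1/p_1,1/p_2]$, $\mathbb{Z}[1/p_2]$ the subrings of $\mathbb{Q}$ generated by the indicated fractions). For each $\alpha<\omega$ fix integers $c_\alpha,d_\alpha$ with $c_\alpha q_1^\alpha+d_\alpha q_2^\alpha=1$; $y_\alpha:=\sum_{k\ge\alpha}c_kq_1^{k-\alpha}e_k$, $z_\alpha:=\sum_{k\ge\alpha}d_kq_2^{k-\alpha}e_k$. $N$ is the subgroup of $U$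 generated by $M$ and all $\mathbb{Z}[1/p_2]y_\alpha$, $\mathbb{Z}[1/p_2]z_\alpha$, $\alpha<\omega$. -}

module Defs where

open import Data.Nat as ℕ using (ℕ; zero; suc; _<ᵇ_; _∸_)
open import Data.Integer as ℤ using (ℤ; +_)
open import Data.Rational as ℚ using (ℚ; 0ℚ; _/_)
open import Data.Bool using (if_then_else_)
open import Data.Product using (Σ; ∃; _×_; _,_)
open import Data.Sum using (_⊎_)
open import Relation.Binary.PropositionalEquality using (_≡_)
open import Relation.Nullary using (¬_)

ℤ→ℚ : ℤ → ℚ
ℤ→ℚ a = a / 1

ℕ→ℚ : ℕ → ℚ
ℕ→ℚ n = (+ n) / 1

U : Set
U = ℕ → ℚ

_≈U_ : U → U → Set
x ≈U y = ∀ k → x k ≡ y k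

0U : U
0U k = 0ℚ

_+U_ : U → U → U
(x +U y) k = x k ℚ.+ y k

-U_ : U → U
(-U x) k = ℚ.- (x k)

_·U_ : ℚ → U → U
(r ·U x) k = r ℚ.* x k

_⋆U_ : ℕ → U → U
n ⋆U x = ℕ→ℚ n ·U x

Subset : Set₁
Subset = U → Set

_⊆_ : Subset → Subset → Set
A ⊆ B = ∀ x → A x → B x

_≐_ : Subset → Subset → Set
A ≐ B = (A ⊆ B) × (B ⊆ A)

IsSubgroup : Subset → Set
IsSubgroup G = (∀ x y → x ≈U y → G x → G y)
             × G 0U
             × (∀ x y → G x → G y → G (x +U y))
             × (∀ x → G x → G (-U x))

_^[_]·_ : ℕ → ℕ → Subset → Subset
(p ^[ n ]· G) x = Σ U λ g → G g × (x ≈U ((p ℕ.^ n) ⋆U g))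

_^ω·_ : ℕ → Subset → Subset
(p ^ω· G) x = ∀ n → (p ^[ n ]· G) x

AtMostCountable : Subset → Set
AtMostCountable S = Σ (ℕ → U) λ f → ∀ x → S x → Σ ℕ λ n → f n ≈U x

TorsionFree : Subset → Set
TorsionFree G = ∀ n x → G x → ¬ (n ≡ 0) → (n ⋆U x) ≈U 0U → x ≈U 0U

_≤p_ : Subset → Subset → Set
G₁ ≤p G₂ = (G₁ ⊆ G₂)
         × (∀ n x → G₁ x → (Σ U λ h → G₂ h × (x ≈U (n ⋆U h)))
                          → Σ U λ h → G₁ h × (x ≈U (n ⋆U h)))

K₁ : ℕ → ℕ → Subset → Set
K₁ p₁ p₂ G = IsSubgroup G × TorsionFree G
           × AtMostCountable (p₁ ^ω· G) × AtMostCountable (p₂ ^ω· G)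

≤K₁ : ℕ → ℕ → Subset → Subset → Set
≤K₁ p₁ p₂ G₁ G₂ = (G₁ ≤p G₂)
                × ((p₁ ^ω· G₁) ≐ (p₁ ^ω· G₂))
                × ((G₁ ≐ (p₁ ^ω· G₁)) ⊎ ((p₂ ^ω· G₁) ≐ (p₂ ^ω· G₂)))

InZ[1/p₁,1/p₂] : ℕ → ℕ → ℚ → Set
InZ[1/p₁,1/p₂] p₁ p₂ q =
  Σ ℤ λ a → Σ ℕ λ i → Σ ℕ λ j → q ℚ.* ℕ→ℚ ((p₁ ℕ.^ i) ℕ.* (p₂ ℕ.^ j)) ≡ ℤ→ℚ a

InZ[1/p] : ℕ → ℚ → Set
InZ[1/p] p q = Σ ℤ λ a → Σ ℕ λ i → q ℚ.* ℕ→ℚ (p ℕ.^ i) ≡ ℤ→ℚ a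

Mset : ℕ → ℕ → Subset
Mset p₁ p₂ x = (∀ k → InZ[1/p₁,1/p₂] p₁ p₂ (x k))
             × Σ ℕ λ n → ∀ k → n ℕ.≤ k → x k ≡ 0ℚ

-- w_α = Σ_{k≥α} c_k q^{k-α} e_k  (y_α with (c,q₁), z_α with (d,q₂))
tailVec : (ℕ → ℤ) → ℕ → ℕ → U
tailVec c q α k = if k <ᵇ α then 0ℚ else ℤ→ℚ (c k ℤ.* (+ (q ℕ.^ (k ∸ α))))

yv : ℕ → (ℕ → ℤ) → ℕ → U
yv q₁ c α = tailVec c q₁ α

zv : ℕ → (ℕ → ℤ) → ℕ → U
zv q₂ d α = tailVec d q₂ α

data Nset (p₁ p₂ q₁ q₂ : ℕ) (c d : ℕ → ℤ) : Subset where
  n-M   : ∀ x → Mset p₁ p₂ x → Nset p₁ p₂ q₁ q₂ c d x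
  n-y   : ∀ α r → InZ[1/p] p₂ r → Nset p₁ p₂ q₁ q₂ c d (r ·U yv q₁ c α)
  n-z   : ∀ α s → InZ[1/p] p₂ s → Nset p₁ p₂ q₁ q₂ c d (s ·U zv q₂ d α)
  n-0   : Nset p₁ p₂ q₁ q₂ c d 0U
  n-+   : ∀ x y → Nset p₁ p₂ q₁ q₂ c d x → Nset p₁ p₂ q₁ q₂ c d y
        → Nset p₁ p₂ q₁ q₂ c d (x +U y)
  n-neg : ∀ x → Nset p₁ p₂ q₁ q₂ c d x → Nset p₁ p₂ q₁ q₂ c d (-U x)
  n-≈   : ∀ x y → x ≈U y → Nset p₁ p₂ q₁ q₂ c d x → Nset p₁ p₂ q₁ q₂ c d y

module Submission where

-- Write u = y₀ and v = z₀; from index α on, y_α agrees with q₁^(-α) u and z_α with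
-- q₂^(-α) v.  Hence every x ∈ N agrees, from some index on, with A u + B v for coefficients
-- A, B in ℤ₍p₁₎, the rationals with denominator prime to p₁: this holds for the generators
-- (with A = B = 0 on M, whose elements are eventually 0) and is preserved by sums and
-- negatives.  The coefficients are unique: if A u + B v vanishes from K on, then
-- c_k q₁^k + d_k q₂^k = 1 gives B = (B - A) c_k q₁^k for all k ≥ K, so B is divisible by
-- arbitrarily high powers of q₁ and is 0, and likewise A = 0.  If x ∈ p₁^ω N, comparing the
-- tails of x and of g in x = p₁ⁿ g puts the coefficients of x in ⋂ₙ p₁ⁿ ℤ₍p₁₎ = 0, so x is
-- eventually 0, i.e. x ∈ M.  This gives (1) and p₁^ω N = M; the other equalities come from
-- dividing the generators of M and N by powers of p₁ and p₂, and N is countable because an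
-- element is determined by a finite prefix and its two tail coefficients.

open import Data.Bool using (true; false; T)
open import Data.Integer as ℤ using (ℤ; +_; -[1+_]; ∣_∣)
import Data.Integer.Properties as ℤ
open import Data.Integer.Tactic.RingSolver as ℤ-Solver using ()
open import Data.Nat as ℕ using (ℕ; zero; suc; z≤n; s≤s; _≤_; _<_; _^_; _∸_; _<ᵇ_; _⊔_; NonZero)
import Data.Nat.Properties as ℕ
import Data.Nat.Tactic.RingSolver as ℕ-Solver
open import Data.Nat.Divisibility using (_∣_; divides; 1∣_; _∣0; ∣⇒≤; ∣1⇒≡1; ∣-trans; m∣m*n; *-monoʳ-∣; *-cancelˡ-∣)
open import Data.Nat.Primality using (Prime; euclidsLemma; prime⇒irreducible; prime⇒nonZero; prime⇒nonTrivial; ¬prime[1])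
open import Data.Product using (∃; ∃₂; _×_; _,_; proj₁; proj₂; map; uncurry)
open import Data.Rational as ℚ using (ℚ; 0ℚ; 1ℚ; _+_; _*_; -_; _-_; ↥_; ↧_; mkℚ; toℚᵘ)
import Data.Rational.Properties as ℚ
open import Data.Rational.Solver using (module +-*-Solver)
import Data.Rational.Unnormalised as ℚᵘ
import Data.Rational.Unnormalised.Properties as ℚᵘ
open import Data.Sum using (_⊎_; inj₁; inj₂)
open import Data.Unit using (tt)
open import Function using (_∘_; id)
open import Relation.Binary.PropositionalEquality
open import Relation.Nullary using (¬_; yes; no; contradiction)

open import Defs

open +-*-Solver using (solve; _:+_; _:*_; _:-_; :-_; _:=_)

toℚᵘ-ℤ→ℚ : ∀ a → toℚᵘ (ℤ→ℚ a) ℚᵘ.≃ ℚᵘ.mkℚᵘ a 0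
toℚᵘ-ℤ→ℚ a = ℚ.toℚᵘ-fromℚᵘ (ℚᵘ.mkℚᵘ a 0)

ℤ→ℚ-+ : ∀ a b → ℤ→ℚ (a ℤ.+ b) ≡ ℤ→ℚ a + ℤ→ℚ b
ℤ→ℚ-+ a b = ℚ.toℚᵘ-injective (begin
  toℚᵘ (ℤ→ℚ (a ℤ.+ b))                   ≈⟨ toℚᵘ-ℤ→ℚ (a ℤ.+ b) ⟩
  ℚᵘ.mkℚᵘ (a ℤ.+ b) 0                    ≈⟨ ℚᵘ.*≡* (ℤ-identity a b) ⟩
  ℚᵘ.mkℚᵘ a 0 ℚᵘ.+ ℚᵘ.mkℚᵘ b 0           ≈⟨ ℚᵘ.+-cong (toℚᵘ-ℤ→ℚ a) (toℚᵘ-ℤ→ℚ b) ⟨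
  toℚᵘ (ℤ→ℚ a) ℚᵘ.+ toℚᵘ (ℤ→ℚ b)         ≈⟨ ℚ.toℚᵘ-homo-+ (ℤ→ℚ a) (ℤ→ℚ b) ⟨
  toℚᵘ (ℤ→ℚ a + ℤ→ℚ b)                   ∎)
  where
  open ℚᵘ.≃-Reasoning
  ℤ-identity : ∀ a b → (a ℤ.+ b) ℤ.* + 1 ≡ (a ℤ.* + 1 ℤ.+ b ℤ.* + 1) ℤ.* + 1
  ℤ-identity = ℤ-Solver.solve-∀

ℤ→ℚ-* : ∀ a b → ℤ→ℚ (a ℤ.* b) ≡ ℤ→ℚ a * ℤ→ℚ b
ℤ→ℚ-* a b = ℚ.toℚᵘ-injective (begin
  toℚᵘ (ℤ→ℚ (a ℤ.* b))                   ≈⟨ toℚᵘ-ℤ→ℚ (a ℤ.* b) ⟩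
  ℚᵘ.mkℚᵘ a 0 ℚᵘ.* ℚᵘ.mkℚᵘ b 0           ≈⟨ ℚᵘ.*-cong (toℚᵘ-ℤ→ℚ a) (toℚᵘ-ℤ→ℚ b) ⟨
  toℚᵘ (ℤ→ℚ a) ℚᵘ.* toℚᵘ (ℤ→ℚ b)         ≈⟨ ℚ.toℚᵘ-homo-* (ℤ→ℚ a) (ℤ→ℚ b) ⟨
  toℚᵘ (ℤ→ℚ a * ℤ→ℚ b)                   ∎)
  where open ℚᵘ.≃-Reasoning

ℤ→ℚ-injective : ∀ {a b} → ℤ→ℚ a ≡ ℤ→ℚ b → a ≡ b
ℤ→ℚ-injective {a} {b} eq with ℚ.fromℚᵘ-injective {ℚᵘ.mkℚᵘ a 0} {ℚᵘ.mkℚᵘ b 0} eq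
... | ℚᵘ.*≡* a*1≡b*1 = begin
  a         ≡⟨ ℤ.*-identityʳ a ⟨
  a ℤ.* + 1 ≡⟨ a*1≡b*1 ⟩
  b ℤ.* + 1 ≡⟨ ℤ.*-identityʳ b ⟩
  b         ∎
  where open ≡-Reasoning

+-^ : ∀ q k → + (q ^ k) ≡ (+ q) ℤ.^ k
+-^ q zero    = refl
+-^ q (suc k) = trans (ℤ.pos-* q (q ^ k)) (cong (+ q ℤ.*_) (+-^ q k))

ℕ→ℚ-* : ∀ m n → ℕ→ℚ (m ℕ.* n) ≡ ℕ→ℚ m * ℕ→ℚ n
ℕ→ℚ-* m n = trans (cong ℤ→ℚ (ℤ.pos-* m n)) (ℤ→ℚ-* (+ m) (+ n))

ℕ→ℚ-≢0 : ∀ {m} → m ≢ 0 → ℕ→ℚ m ≢ 0ℚ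
ℕ→ℚ-≢0 m≢0 eq = m≢0 (ℤ.+-injective (ℤ→ℚ-injective eq))

*-↧≡↥ : ∀ r → r * ℤ→ℚ (↧ r) ≡ ℤ→ℚ (↥ r)
*-↧≡↥ r@(mkℚ n d _) = ℚ.toℚᵘ-injective (begin
  toℚᵘ (r * ℤ→ℚ (↧ r))                   ≈⟨ ℚ.toℚᵘ-homo-* r (ℤ→ℚ (↧ r)) ⟩
  toℚᵘ r ℚᵘ.* toℚᵘ (ℤ→ℚ (↧ r))           ≈⟨ ℚᵘ.*-congˡ {toℚᵘ r} (toℚᵘ-ℤ→ℚ (↧ r)) ⟩
  ℚᵘ.mkℚᵘ n d ℚᵘ.* ℚᵘ.mkℚᵘ (↧ r) 0       ≈⟨ ℚᵘ.*≡* (ℤ-identity n d) ⟩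
  ℚᵘ.mkℚᵘ n 0                            ≈⟨ toℚᵘ-ℤ→ℚ n ⟨
  toℚᵘ (ℤ→ℚ n)                           ∎)
  where
  open ℚᵘ.≃-Reasoning
  ℤ-identity : ∀ n d → (n ℤ.* + suc d) ℤ.* + 1 ≡ n ℤ.* + (suc d ℕ.* 1)
  ℤ-identity n d rewrite ℕ.*-identityʳ (suc d) = ℤ.*-identityʳ (n ℤ.* + suc d)

*-zero-product : ∀ r s → r * s ≡ 0ℚ → r ≡ 0ℚ ⊎ s ≡ 0ℚ
*-zero-product r@record{} s@record{} rs≡0 with ℤ.i*j≡0⇒i≡0∨j≡0 (↥ r) ↥rs≡0
  where
  ↥rs≡0 : ↥ r ℤ.* ↥ s ≡ + 0
  ↥rs≡0 = ℚᵘ.p≃0⇒↥p≡0 _ (ℚᵘ.≃-trans (ℚᵘ.≃-sym (ℚ.toℚᵘ-homo-* r s)) (ℚ.toℚᵘ-cong rs≡0))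
... | inj₁ ↥r≡0 = inj₁ (ℚ.↥p≡0⇒p≡0 r ↥r≡0)
... | inj₂ ↥s≡0 = inj₂ (ℚ.↥p≡0⇒p≡0 s ↥s≡0)

ℕ→ℚ-*≡0⇒≡0 : ∀ {m r} → m ≢ 0 → ℕ→ℚ m * r ≡ 0ℚ → r ≡ 0ℚ
ℕ→ℚ-*≡0⇒≡0 {m} {r} m≢0 mr≡0 with *-zero-product (ℕ→ℚ m) r mr≡0
... | inj₁ m≡0 = contradiction m≡0 (ℕ→ℚ-≢0 m≢0)
... | inj₂ r≡0 = r≡0

p≡p-q+q : ∀ p q → p ≡ (p - q) + q
p≡p-q+q = solve 2 (λ p q → p := (p :- q) :+ q) refl

p-q≡0⇒p≡q : ∀ {p q} → p - q ≡ 0ℚ → p ≡ q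
p-q≡0⇒p≡q {p} {q} p-q≡0 = begin
  p              ≡⟨ p≡p-q+q p q ⟩
  (p - q) + q    ≡⟨ cong (_+ q) p-q≡0 ⟩
  0ℚ + q         ≡⟨ ℚ.+-identityˡ q ⟩
  q              ∎
  where open ≡-Reasoning

1/ℕ : (m : ℕ) → .{{NonZero m}} → ℚ
1/ℕ m = + 1 ℚ./ m

*-1/ℕ : ∀ m .{{_ : NonZero m}} → ℕ→ℚ m * 1/ℕ m ≡ 1ℚ
*-1/ℕ (suc m) = ℚ.toℚᵘ-injective (begin
  toℚᵘ (ℕ→ℚ (suc m) * 1/ℕ (suc m))                 ≈⟨ ℚ.toℚᵘ-homo-* (ℕ→ℚ (suc m)) (1/ℕ (suc m)) ⟩
  toℚᵘ (ℕ→ℚ (suc m)) ℚᵘ.* toℚᵘ (1/ℕ (suc m))       ≈⟨ ℚᵘ.*-cong (toℚᵘ-ℤ→ℚ (+ suc m)) (ℚ.toℚᵘ-fromℚᵘ (ℚᵘ.mkℚᵘ (+ 1) m)) ⟩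
  ℚᵘ.mkℚᵘ (+ suc m) 0 ℚᵘ.* ℚᵘ.mkℚᵘ (+ 1) m         ≈⟨ ℚᵘ.*≡* (cong (λ n → + suc n) (ℕ-identity m)) ⟩
  ℚᵘ.1ℚᵘ                                           ∎)
  where
  open ℚᵘ.≃-Reasoning
  ℕ-identity : ∀ m → m ℕ.* 1 ℕ.* 1 ≡ m ℕ.+ 0 ℕ.+ 0
  ℕ-identity = ℕ-Solver.solve-∀

infix 8 1/_^_

1/_^_ : (q : ℕ) .{{_ : NonZero q}} → ℕ → ℚ
1/ q ^ n = 1/ℕ (q ^ n) {{ℕ.m^n≢0 q n}}

*-1/ℕ-cancelˡ : ∀ m .{{_ : NonZero m}} r → ℕ→ℚ m * (1/ℕ m * r) ≡ r
*-1/ℕ-cancelˡ m r = begin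
  ℕ→ℚ m * (1/ℕ m * r)    ≡⟨ ℚ.*-assoc (ℕ→ℚ m) (1/ℕ m) r ⟨
  (ℕ→ℚ m * 1/ℕ m) * r    ≡⟨ cong (_* r) (*-1/ℕ m) ⟩
  1ℚ * r                 ≡⟨ ℚ.*-identityˡ r ⟩
  r                      ∎
  where open ≡-Reasoning

*-1/ℕ≡0⇒≡0 : ∀ m .{{_ : NonZero m}} {r} → r * 1/ℕ m ≡ 0ℚ → r ≡ 0ℚ
*-1/ℕ≡0⇒≡0 m {r} r/m≡0 = begin
  r                        ≡⟨ *-1/ℕ-cancelˡ m r ⟨
  ℕ→ℚ m * (1/ℕ m * r)      ≡⟨ cong (ℕ→ℚ m *_) (ℚ.*-comm (1/ℕ m) r) ⟩
  ℕ→ℚ m * (r * 1/ℕ m)      ≡⟨ cong (ℕ→ℚ m *_) r/m≡0 ⟩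
  ℕ→ℚ m * 0ℚ               ≡⟨ ℚ.*-zeroʳ (ℕ→ℚ m) ⟩
  0ℚ                       ∎
  where open ≡-Reasoning

-- Divisibility

n<q^n : ∀ {q} → 1 < q → ∀ n → n < q ^ n
n<q^n 1<q zero = s≤s z≤n
n<q^n {q} 1<q (suc n) = begin-strict
  suc n           ≤⟨ n<q^n 1<q n ⟩
  q ^ n           <⟨ ℕ.m<m*n (q ^ n) q 1<q ⟩
  q ^ n ℕ.* q     ≡⟨ ℕ.*-comm (q ^ n) q ⟩
  q ^ suc n       ∎
  where
  open ℕ.≤-Reasoning
  instance _ = ℕ.m^n≢0 q n {{ℕ.>-nonZero (ℕ.<-trans (s≤s z≤n) 1<q)}}

eventually-∣-all-powers⇒≡0 : ∀ {q a} K → 1 < q → (∀ n → K ≤ n → q ^ n ∣ a) → a ≡ 0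
eventually-∣-all-powers⇒≡0 {a = zero} K 1<q div = refl
eventually-∣-all-powers⇒≡0 {q} {suc m} K 1<q div =
  contradiction (∣⇒≤ (div (K ℕ.+ suc m) (ℕ.m≤m+n K (suc m)))) (ℕ.<⇒≱ (begin-strict
    suc m               ≤⟨ ℕ.m≤n+m (suc m) K ⟩
    K ℕ.+ suc m         <⟨ n<q^n 1<q (K ℕ.+ suc m) ⟩
    q ^ (K ℕ.+ suc m)   ∎))
  where open ℕ.≤-Reasoning

prime-∤-* : ∀ {p m n} → Prime p → ¬ p ∣ m → ¬ p ∣ n → ¬ p ∣ m ℕ.* n
prime-∤-* {m = m} {n} pp p∤m p∤n p∣mn with euclidsLemma m n pp p∣mn
... | inj₁ p∣m = p∤m p∣m
... | inj₂ p∣n = p∤n p∣n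

prime-∤-1 : ∀ {p} → Prime p → ¬ p ∣ 1
prime-∤-1 pp p∣1 = ¬prime[1] (subst Prime (∣1⇒≡1 p∣1) pp)

prime-∤-^ : ∀ {p m} → Prime p → ¬ p ∣ m → ∀ n → ¬ p ∣ m ^ n
prime-∤-^ pp p∤m zero = prime-∤-1 pp
prime-∤-^ pp p∤m (suc n) = prime-∤-* pp p∤m (prime-∤-^ pp p∤m n)

prime-∤-prime : ∀ {p q} → Prime p → Prime q → p ≢ q → ¬ p ∣ q
prime-∤-prime pp pq p≢q p∣q with prime⇒irreducible pq p∣q
... | inj₁ p≡1 = ¬prime[1] (subst Prime p≡1 pp)
... | inj₂ p≡q = p≢q p≡q

prime^-∣-cancelˡ : ∀ {p m} → Prime p → ¬ p ∣ m → ∀ n {a} → p ^ n ∣ m ℕ.* a → p ^ n ∣ a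
prime^-∣-cancelˡ pp p∤m zero _ = 1∣ _
prime^-∣-cancelˡ {p} {m} pp p∤m (suc n) {a} pⁿ⁺¹∣ma
  with euclidsLemma m a pp (∣-trans (m∣m*n (p ^ n)) pⁿ⁺¹∣ma)
... | inj₁ p∣m = contradiction p∣m p∤m
... | inj₂ (divides b refl) = subst (p ^ suc n ∣_) (ℕ.*-comm p b) (*-monoʳ-∣ p pⁿ∣b)
  where
  instance _ = prime⇒nonZero pp
  pⁿ∣b : p ^ n ∣ b
  pⁿ∣b = prime^-∣-cancelˡ pp p∤m n (*-cancelˡ-∣ p (subst (p ^ suc n ∣_) (ℕ-identity m b p) pⁿ⁺¹∣ma))
    where
    ℕ-identity : ∀ m b p → m ℕ.* (b ℕ.* p) ≡ p ℕ.* (m ℕ.* b)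
    ℕ-identity = ℕ-Solver.solve-∀

↥*↧-multiple : ∀ {B C} t → B ≡ C * ℤ→ℚ t → ↥ B ℤ.* ↧ C ≡ ↥ C ℤ.* (↧ B ℤ.* t)
↥*↧-multiple {B} {C} t B≡Ct = ℤ→ℚ-injective (begin
  ℤ→ℚ (↥ B ℤ.* ↧ C)                          ≡⟨ ℤ→ℚ-* (↥ B) (↧ C) ⟩
  ℤ→ℚ (↥ B) * ℤ→ℚ (↧ C)                      ≡⟨ cong (_* ℤ→ℚ (↧ C)) (*-↧≡↥ B) ⟨
  (B * ℤ→ℚ (↧ B)) * ℤ→ℚ (↧ C)                ≡⟨ cong (λ x → (x * ℤ→ℚ (↧ B)) * ℤ→ℚ (↧ C)) B≡Ct ⟩
  ((C * ℤ→ℚ t) * ℤ→ℚ (↧ B)) * ℤ→ℚ (↧ C)      ≡⟨ ℚ-identity C (ℤ→ℚ t) (ℤ→ℚ (↧ B)) (ℤ→ℚ (↧ C)) ⟩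
  (C * ℤ→ℚ (↧ C)) * (ℤ→ℚ (↧ B) * ℤ→ℚ t)      ≡⟨ cong₂ _*_ (*-↧≡↥ C) (sym (ℤ→ℚ-* (↧ B) t)) ⟩
  ℤ→ℚ (↥ C) * ℤ→ℚ (↧ B ℤ.* t)                ≡⟨ ℤ→ℚ-* (↥ C) (↧ B ℤ.* t) ⟨
  ℤ→ℚ (↥ C ℤ.* (↧ B ℤ.* t))                  ∎)
  where
  open ≡-Reasoning
  ℚ-identity : ∀ C T b c → ((C * T) * b) * c ≡ (C * c) * (b * T)
  ℚ-identity = solve 4 (λ C T b c → ((C :* T) :* b) :* c := (C :* c) :* (b :* T)) refl

↥*↧≡0⇒≡0 : ∀ {B C} → ↥ B ℤ.* ↧ C ≡ + 0 → B ≡ 0ℚ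
↥*↧≡0⇒≡0 {B} {C} eq with ℤ.i*j≡0⇒i≡0∨j≡0 (↥ B) eq
... | inj₁ ↥B≡0 = ℚ.↥p≡0⇒p≡0 B ↥B≡0
... | inj₂ ()

eventually-multiple-of-powers⇒0 : ∀ {q K B C} → 1 < q
  → (∀ k → K ≤ k → ∃ λ t → B ≡ C * ℤ→ℚ (t ℤ.* + (q ^ k))) → B ≡ 0ℚ
eventually-multiple-of-powers⇒0 {q} {K} {B} {C} 1<q multiple =
  ↥*↧≡0⇒≡0 {B} {C} (ℤ.∣i∣≡0⇒i≡0 (eventually-∣-all-powers⇒≡0 K 1<q qᵏ∣∣↥B↧C∣))
  where
  qᵏ∣∣↥B↧C∣ : ∀ k → K ≤ k → q ^ k ∣ ∣ ↥ B ℤ.* ↧ C ∣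
  qᵏ∣∣↥B↧C∣ k K≤k with multiple k K≤k
  ... | t , B≡Ctqᵏ = divides ∣ ↥ C ℤ.* ↧ B ℤ.* t ∣ (begin
    ∣ ↥ B ℤ.* ↧ C ∣                                ≡⟨ cong ∣_∣ (↥*↧-multiple {B} {C} (t ℤ.* + (q ^ k)) B≡Ctqᵏ) ⟩
    ∣ ↥ C ℤ.* (↧ B ℤ.* (t ℤ.* + (q ^ k))) ∣        ≡⟨ cong ∣_∣ (ℤ-identity (↥ C) (↧ B) t (+ (q ^ k))) ⟩
    ∣ (↥ C ℤ.* ↧ B ℤ.* t) ℤ.* + (q ^ k) ∣          ≡⟨ ℤ.abs-* (↥ C ℤ.* ↧ B ℤ.* t) (+ (q ^ k)) ⟩
    ∣ ↥ C ℤ.* ↧ B ℤ.* t ∣ ℕ.* q ^ k                ∎)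
    where
    open ≡-Reasoning
    ℤ-identity : ∀ a b t Q → a ℤ.* (b ℤ.* (t ℤ.* Q)) ≡ (a ℤ.* b ℤ.* t) ℤ.* Q
    ℤ-identity = ℤ-Solver.solve-∀

-- Localisations of ℤ

-- The localisation S⁻¹ℤ; the rings ℤ[1/p], ℤ[1/p₁,1/p₂] and ℤ₍p₎ are instances.
record _⁻¹ℤ (S : ℕ → Set) (r : ℚ) : Set where
  constructor fraction
  field
    denominator : ℕ
    denominator∈S : S denominator
    numerator : ℤ
    *-denominator≡numerator : r * ℕ→ℚ denominator ≡ ℤ→ℚ numerator

record MultiplicativelyClosed (S : ℕ → Set) : Set where
  field
    1∈ : S 1
    *-closed : ∀ {m n} → S m → S n → S (m ℕ.* n)

⁻¹ℤ-mono : ∀ {S T : ℕ → Set} → (∀ {m} → S m → T m) → ∀ {r} → (S ⁻¹ℤ) r → (T ⁻¹ℤ) r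
⁻¹ℤ-mono S⊆T (fraction m Sm a rm≡a) = fraction m (S⊆T Sm) a rm≡a

module _ {S : ℕ → Set} (S-closed : MultiplicativelyClosed S) where
  open MultiplicativelyClosed S-closed

  ⁻¹ℤ-ℤ : ∀ a → (S ⁻¹ℤ) (ℤ→ℚ a)
  ⁻¹ℤ-ℤ a = fraction 1 1∈ a (ℚ.*-identityʳ (ℤ→ℚ a))

  ⁻¹ℤ-+ : ∀ {r s} → (S ⁻¹ℤ) r → (S ⁻¹ℤ) s → (S ⁻¹ℤ) (r + s)
  ⁻¹ℤ-+ {r} {s} (fraction m Sm a rm≡a) (fraction n Sn b sn≡b) =
    fraction (m ℕ.* n) (*-closed Sm Sn) (a ℤ.* + n ℤ.+ b ℤ.* + m) (begin
      (r + s) * ℕ→ℚ (m ℕ.* n)                         ≡⟨ cong ((r + s) *_) (ℕ→ℚ-* m n) ⟩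
      (r + s) * (ℕ→ℚ m * ℕ→ℚ n)                       ≡⟨ ℚ-identity r s (ℕ→ℚ m) (ℕ→ℚ n) ⟩
      (r * ℕ→ℚ m) * ℕ→ℚ n + (s * ℕ→ℚ n) * ℕ→ℚ m       ≡⟨ cong₂ (λ x y → x * ℕ→ℚ n + y * ℕ→ℚ m) rm≡a sn≡b ⟩
      ℤ→ℚ a * ℤ→ℚ (+ n) + ℤ→ℚ b * ℤ→ℚ (+ m)           ≡⟨ cong₂ _+_ (ℤ→ℚ-* a (+ n)) (ℤ→ℚ-* b (+ m)) ⟨
      ℤ→ℚ (a ℤ.* + n) + ℤ→ℚ (b ℤ.* + m)               ≡⟨ ℤ→ℚ-+ (a ℤ.* + n) (b ℤ.* + m) ⟨
      ℤ→ℚ (a ℤ.* + n ℤ.+ b ℤ.* + m)                   ∎)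
    where
    open ≡-Reasoning
    ℚ-identity : ∀ r s m n → (r + s) * (m * n) ≡ (r * m) * n + (s * n) * m
    ℚ-identity = solve 4 (λ r s m n → (r :+ s) :* (m :* n) := (r :* m) :* n :+ (s :* n) :* m) refl

  ⁻¹ℤ-* : ∀ {r s} → (S ⁻¹ℤ) r → (S ⁻¹ℤ) s → (S ⁻¹ℤ) (r * s)
  ⁻¹ℤ-* {r} {s} (fraction m Sm a rm≡a) (fraction n Sn b sn≡b) =
    fraction (m ℕ.* n) (*-closed Sm Sn) (a ℤ.* b) (begin
      (r * s) * ℕ→ℚ (m ℕ.* n)           ≡⟨ cong ((r * s) *_) (ℕ→ℚ-* m n) ⟩
      (r * s) * (ℕ→ℚ m * ℕ→ℚ n)         ≡⟨ ℚ-identity r s (ℕ→ℚ m) (ℕ→ℚ n) ⟩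
      (r * ℕ→ℚ m) * (s * ℕ→ℚ n)         ≡⟨ cong₂ _*_ rm≡a sn≡b ⟩
      ℤ→ℚ a * ℤ→ℚ b                     ≡⟨ ℤ→ℚ-* a b ⟨
      ℤ→ℚ (a ℤ.* b)                     ∎)
    where
    open ≡-Reasoning
    ℚ-identity : ∀ r s m n → (r * s) * (m * n) ≡ (r * m) * (s * n)
    ℚ-identity = solve 4 (λ r s m n → (r :* s) :* (m :* n) := (r :* m) :* (s :* n)) refl

  ⁻¹ℤ-neg : ∀ {r} → (S ⁻¹ℤ) r → (S ⁻¹ℤ) (- r)
  ⁻¹ℤ-neg {r} r∈ = subst (S ⁻¹ℤ) -1*r≡-r (⁻¹ℤ-* (⁻¹ℤ-ℤ (ℤ.- + 1)) r∈)
    where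
    -1*r≡-r : - 1ℚ * r ≡ - r
    -1*r≡-r = trans (sym (ℚ.neg-distribˡ-* 1ℚ r)) (cong -_ (ℚ.*-identityˡ r))

  ⁻¹ℤ-1/ℕ : ∀ {m} .{{_ : NonZero m}} → S m → (S ⁻¹ℤ) (1/ℕ m)
  ⁻¹ℤ-1/ℕ {m} Sm = fraction m Sm (+ 1) (trans (ℚ.*-comm (1/ℕ m) (ℕ→ℚ m)) (*-1/ℕ m))

PowerOf : ℕ → ℕ → Set
PowerOf p m = ∃ λ i → p ^ i ≡ m

powerOf-closed : ∀ p → MultiplicativelyClosed (PowerOf p)
powerOf-closed p = record
  { 1∈       = 0 , refl
  ; *-closed = λ { (i , refl) (j , refl) → i ℕ.+ j , ℕ.^-distribˡ-+-* p i j }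
  }

ProductOfPowers : ℕ → ℕ → ℕ → Set
ProductOfPowers p q m = ∃₂ λ i j → p ^ i ℕ.* q ^ j ≡ m

productOfPowers-closed : ∀ p q → MultiplicativelyClosed (ProductOfPowers p q)
productOfPowers-closed p q = record
  { 1∈       = 0 , 0 , refl
  ; *-closed = λ { (i , j , refl) (i′ , j′ , refl) → i ℕ.+ i′ , j ℕ.+ j′ , powers-* i j i′ j′ }
  }
  where
  powers-* : ∀ i j i′ j′ → p ^ (i ℕ.+ i′) ℕ.* q ^ (j ℕ.+ j′) ≡ (p ^ i ℕ.* q ^ j) ℕ.* (p ^ i′ ℕ.* q ^ j′)
  powers-* i j i′ j′ rewrite ℕ.^-distribˡ-+-* p i i′ | ℕ.^-distribˡ-+-* q j j′ =
    ℕ-identity (p ^ i) (p ^ i′) (q ^ j) (q ^ j′)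
    where
    ℕ-identity : ∀ a a′ b b′ → (a ℕ.* a′) ℕ.* (b ℕ.* b′) ≡ (a ℕ.* b) ℕ.* (a′ ℕ.* b′)
    ℕ-identity = ℕ-Solver.solve-∀

ℤ₍_₎ : ℕ → ℚ → Set
ℤ₍ p ₎ = (λ m → ¬ p ∣ m) ⁻¹ℤ

primeTo-closed : ∀ {p} → Prime p → MultiplicativelyClosed (λ m → ¬ p ∣ m)
primeTo-closed pp = record { 1∈ = prime-∤-1 pp ; *-closed = prime-∤-* pp }

pⁿℤ₍p₎ : ℕ → ℕ → ℚ → Set
pⁿℤ₍p₎ p n r = ∃ λ s → ℤ₍ p ₎ s × r ≡ ℕ→ℚ (p ^ n) * s

pⁿ∣numerator : ∀ {p r} → Prime p → ∀ m a → r * ℕ→ℚ m ≡ ℤ→ℚ a → ∀ n → pⁿℤ₍p₎ p n r → p ^ n ∣ ∣ a ∣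
pⁿ∣numerator {p} {r} pp m a rm≡a n (s , fraction m′ p∤m′ b sm′≡b , r≡pⁿs) =
  prime^-∣-cancelˡ pp p∤m′ n (divides ∣ b ℤ.* + m ∣ (begin
    m′ ℕ.* ∣ a ∣                          ≡⟨ ℤ.abs-* (+ m′) a ⟨
    ∣ + m′ ℤ.* a ∣                        ≡⟨ cong ∣_∣ (ℤ→ℚ-injective {+ m′ ℤ.* a} {(b ℤ.* + m) ℤ.* + (p ^ n)} ℚ-equation) ⟩
    ∣ (b ℤ.* + m) ℤ.* + (p ^ n) ∣         ≡⟨ ℤ.abs-* (b ℤ.* + m) (+ (p ^ n)) ⟩
    ∣ b ℤ.* + m ∣ ℕ.* p ^ n               ∎))
  where
  open ≡-Reasoning
  ℚ-identity : ∀ m′ s m P → m′ * ((P * s) * m) ≡ (s * m′) * m * P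
  ℚ-identity = solve 4 (λ m′ s m P → m′ :* ((P :* s) :* m) := (s :* m′) :* m :* P) refl
  ℚ-equation : ℤ→ℚ (+ m′ ℤ.* a) ≡ ℤ→ℚ ((b ℤ.* + m) ℤ.* + (p ^ n))
  ℚ-equation = begin
    ℤ→ℚ (+ m′ ℤ.* a)                                  ≡⟨ ℤ→ℚ-* (+ m′) a ⟩
    ℕ→ℚ m′ * ℤ→ℚ a                                    ≡⟨ cong (ℕ→ℚ m′ *_) rm≡a ⟨
    ℕ→ℚ m′ * (r * ℕ→ℚ m)                              ≡⟨ cong (λ x → ℕ→ℚ m′ * (x * ℕ→ℚ m)) r≡pⁿs ⟩
    ℕ→ℚ m′ * ((ℕ→ℚ (p ^ n) * s) * ℕ→ℚ m)              ≡⟨ ℚ-identity (ℕ→ℚ m′) s (ℕ→ℚ m) (ℕ→ℚ (p ^ n)) ⟩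
    (s * ℕ→ℚ m′) * ℕ→ℚ m * ℕ→ℚ (p ^ n)                ≡⟨ cong (λ x → x * ℕ→ℚ m * ℕ→ℚ (p ^ n)) sm′≡b ⟩
    ℤ→ℚ b * ℤ→ℚ (+ m) * ℤ→ℚ (+ (p ^ n))               ≡⟨ cong (_* ℤ→ℚ (+ (p ^ n))) (ℤ→ℚ-* b (+ m)) ⟨
    ℤ→ℚ (b ℤ.* + m) * ℤ→ℚ (+ (p ^ n))                 ≡⟨ ℤ→ℚ-* (b ℤ.* + m) (+ (p ^ n)) ⟨
    ℤ→ℚ ((b ℤ.* + m) ℤ.* + (p ^ n))                   ∎

⋂pⁿℤ₍p₎≡0 : ∀ {p r} → Prime p → (∀ n → pⁿℤ₍p₎ p n r) → r ≡ 0ℚ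
⋂pⁿℤ₍p₎≡0 {p} {r} pp divisible = vanish (divisible 0)
  where
  vanish : pⁿℤ₍p₎ p 0 r → r ≡ 0ℚ
  vanish (s , fraction m p∤m a sm≡a , r≡1s) =
    ℕ→ℚ-*≡0⇒≡0 m≢0 (trans (ℚ.*-comm (ℕ→ℚ m) r) (trans rm≡a (cong ℤ→ℚ a≡0)))
    where
    m≢0 : m ≢ 0
    m≢0 refl = p∤m (p ∣0)
    rm≡a : r * ℕ→ℚ m ≡ ℤ→ℚ a
    rm≡a = trans (cong (_* ℕ→ℚ m) (trans r≡1s (ℚ.*-identityˡ s))) sm≡a
    a≡0 : a ≡ + 0
    a≡0 = ℤ.∣i∣≡0⇒i≡0 (eventually-∣-all-powers⇒≡0 0 (ℕ.nonTrivial⇒n>1 p {{prime⇒nonTrivial pp}})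
            (λ n _ → pⁿ∣numerator pp m a rm≡a n (divisible n)))

ℤ[1/p]⇒⁻¹ℤ : ∀ {p} r → InZ[1/p] p r → (PowerOf p ⁻¹ℤ) r
ℤ[1/p]⇒⁻¹ℤ {p} _ (a , i , rpⁱ≡a) = fraction (p ^ i) (i , refl) a rpⁱ≡a

⁻¹ℤ⇒ℤ[1/p] : ∀ {p r} → (PowerOf p ⁻¹ℤ) r → InZ[1/p] p r
⁻¹ℤ⇒ℤ[1/p] (fraction _ (i , refl) a rpⁱ≡a) = a , i , rpⁱ≡a

ℤ[1/p₁,1/p₂]⇒⁻¹ℤ : ∀ {p₁ p₂} r → InZ[1/p₁,1/p₂] p₁ p₂ r → (ProductOfPowers p₁ p₂ ⁻¹ℤ) r
ℤ[1/p₁,1/p₂]⇒⁻¹ℤ {p₁} {p₂} _ (a , i , j , e) = fraction (p₁ ^ i ℕ.* p₂ ^ j) (i , j , refl) a e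

⁻¹ℤ⇒ℤ[1/p₁,1/p₂] : ∀ {p₁ p₂ r} → (ProductOfPowers p₁ p₂ ⁻¹ℤ) r → InZ[1/p₁,1/p₂] p₁ p₂ r
⁻¹ℤ⇒ℤ[1/p₁,1/p₂] (fraction _ (i , j , refl) a e) = a , i , j , e

^ω·-⊆ : ∀ {G : Subset} p → (∀ x y → x ≈U y → G x → G y) → (p ^ω· G) ⊆ G
^ω·-⊆ p G-resp x x∈pᵚG with x∈pᵚG 0
... | g , g∈G , x≈1g = G-resp g x (λ k → trans (sym (ℚ.*-identityˡ (g k))) (sym (x≈1g k))) g∈G

^ω·-mono : ∀ {G H : Subset} p → G ⊆ H → (p ^ω· G) ⊆ (p ^ω· H)
^ω·-mono p G⊆H x x∈pᵚG n with x∈pᵚG n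
... | g , g∈G , x≈pⁿg = g , G⊆H g g∈G , x≈pⁿg

^[]·-isSubgroup : ∀ {G : Subset} p n → IsSubgroup G → IsSubgroup (p ^[ n ]· G)
^[]·-isSubgroup {G} p n (G-≈ , 0∈G , G-+ , G-neg) =
  ≈-closed , (0U , 0∈G , λ k → sym (ℚ.*-zeroʳ P)) , +-closed , neg-closed
  where
  P = ℕ→ℚ (p ^ n)
  ≈-closed : ∀ x y → x ≈U y → (p ^[ n ]· G) x → (p ^[ n ]· G) y
  ≈-closed x y x≈y (g , g∈G , x≈Pg) = g , g∈G , λ k → trans (sym (x≈y k)) (x≈Pg k)
  +-closed : ∀ x y → (p ^[ n ]· G) x → (p ^[ n ]· G) y → (p ^[ n ]· G) (x +U y)
  +-closed x y (g , g∈G , x≈Pg) (h , h∈G , y≈Ph) = g +U h , G-+ g h g∈G h∈G ,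
    λ k → trans (cong₂ _+_ (x≈Pg k) (y≈Ph k)) (sym (ℚ.*-distribˡ-+ P (g k) (h k)))
  neg-closed : ∀ x → (p ^[ n ]· G) x → (p ^[ n ]· G) (-U x)
  neg-closed x (g , g∈G , x≈Pg) = -U g , G-neg g g∈G ,
    λ k → trans (cong -_ (x≈Pg k)) (ℚ.neg-distribʳ-* P (g k))

⁻¹ℤ-coordinatewise-isSubgroup : ∀ {S} → MultiplicativelyClosed S → IsSubgroup (λ x → ∀ k → (S ⁻¹ℤ) (x k))
⁻¹ℤ-coordinatewise-isSubgroup {S} S-closed =
  (λ x y x≈y x∈ k → subst (S ⁻¹ℤ) (x≈y k) (x∈ k)) , (λ k → ⁻¹ℤ-ℤ S-closed (+ 0)) ,
  (λ x y x∈ y∈ k → ⁻¹ℤ-+ S-closed (x∈ k) (y∈ k)) , (λ x x∈ k → ⁻¹ℤ-neg S-closed (x∈ k))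

torsionFree : ∀ G → TorsionFree G
torsionFree G n x _ n≢0 nx≈0 k = ℕ→ℚ-*≡0⇒≡0 n≢0 (nx≈0 k)

atMostCountable-⊆ : ∀ {S T : Subset} → S ⊆ T → AtMostCountable T → AtMostCountable S
atMostCountable-⊆ S⊆T (f , f-covers) = f , λ x x∈S → f-covers x (S⊆T x x∈S)

≐-sym : ∀ {A B : Subset} → A ≐ B → B ≐ A
≐-sym (A⊆B , B⊆A) = B⊆A , A⊆B

≐-trans : ∀ {A B C : Subset} → A ≐ B → B ≐ C → A ≐ C
≐-trans (A⊆B , B⊆A) (B⊆C , C⊆B) = (λ x x∈A → B⊆C x (A⊆B x x∈A)) , (λ x x∈C → B⊆A x (C⊆B x x∈C))

·U-⋆U-1/ℕ : ∀ m .{{_ : NonZero m}} r w → (r ·U w) ≈U (m ⋆U ((1/ℕ m * r) ·U w))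
·U-⋆U-1/ℕ m r w k = sym (trans (sym (ℚ.*-assoc (ℕ→ℚ m) (1/ℕ m * r) (w k))) (cong (_* w k) (*-1/ℕ-cancelˡ m r)))

-- Tails

infix 4 _≈[_]_

_≈[_]_ : U → ℕ → U → Set
x ≈[ K ] y = ∀ k → K ≤ k → x k ≡ y k

≈[]-trans : ∀ {x y z K K′} → x ≈[ K ] y → y ≈[ K′ ] z → x ≈[ K ⊔ K′ ] z
≈[]-trans {K = K} {K′} x≈y y≈z k K⊔K′≤k =
  trans (x≈y k (ℕ.≤-trans (ℕ.m≤m⊔n K K′) K⊔K′≤k)) (y≈z k (ℕ.≤-trans (ℕ.m≤n⊔m K K′) K⊔K′≤k))

≈[]-+ : ∀ {x x′ y y′ K K′} → x ≈[ K ] x′ → y ≈[ K′ ] y′ → (x +U y) ≈[ K ⊔ K′ ] (x′ +U y′)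
≈[]-+ {K = K} {K′} x≈x′ y≈y′ k K⊔K′≤k =
  cong₂ _+_ (x≈x′ k (ℕ.≤-trans (ℕ.m≤m⊔n K K′) K⊔K′≤k)) (y≈y′ k (ℕ.≤-trans (ℕ.m≤n⊔m K K′) K⊔K′≤k))

<ᵇ-false : ∀ {α k} → α ≤ k → (k <ᵇ α) ≡ false
<ᵇ-false {α} {k} α≤k with k <ᵇ α in k<ᵇα
... | false = refl
... | true  = contradiction (ℕ.<ᵇ⇒< k α (subst T (sym k<ᵇα) tt)) (ℕ.≤⇒≯ α≤k)

tailVec-integral : ∀ c q α k → ∃ λ t → tailVec c q α k ≡ ℤ→ℚ t
tailVec-integral c q α k with k <ᵇ α
... | true  = + 0 , refl
... | false = c k ℤ.* + (q ^ (k ∸ α)) , refl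

tailVec-shift : ∀ c q {α k} → α ≤ k → tailVec c q α k * ℕ→ℚ (q ^ α) ≡ tailVec c q 0 k
tailVec-shift c q {α} {k} α≤k rewrite <ᵇ-false α≤k = begin
  ℤ→ℚ (c k ℤ.* + (q ^ (k ∸ α))) * ℤ→ℚ (+ (q ^ α))    ≡⟨ ℤ→ℚ-* (c k ℤ.* + (q ^ (k ∸ α))) (+ (q ^ α)) ⟨
  ℤ→ℚ (c k ℤ.* + (q ^ (k ∸ α)) ℤ.* + (q ^ α))        ≡⟨ cong ℤ→ℚ (ℤ.*-assoc (c k) (+ (q ^ (k ∸ α))) (+ (q ^ α))) ⟩
  ℤ→ℚ (c k ℤ.* (+ (q ^ (k ∸ α)) ℤ.* + (q ^ α)))      ≡⟨ cong (λ z → ℤ→ℚ (c k ℤ.* z)) (ℤ.pos-* (q ^ (k ∸ α)) (q ^ α)) ⟨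
  ℤ→ℚ (c k ℤ.* + (q ^ (k ∸ α) ℕ.* q ^ α))            ≡⟨ cong (λ z → ℤ→ℚ (c k ℤ.* + z)) (ℕ.^-distribˡ-+-* q (k ∸ α) α) ⟨
  ℤ→ℚ (c k ℤ.* + (q ^ (k ∸ α ℕ.+ α)))                ≡⟨ cong (λ e → ℤ→ℚ (c k ℤ.* + (q ^ e))) (ℕ.m∸n+n≡m α≤k) ⟩
  ℤ→ℚ (c k ℤ.* + (q ^ k))                            ∎
  where open ≡-Reasoning

*-tailVec-shift : ∀ c q {α k} .{{_ : NonZero q}} r → α ≤ k
                → r * tailVec c q α k ≡ (r * 1/ q ^ α) * tailVec c q 0 k
*-tailVec-shift c q {α} {k} r α≤k = begin
  r * y                                    ≡⟨ ℚ.*-identityʳ (r * y) ⟨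
  (r * y) * 1ℚ                             ≡⟨ cong ((r * y) *_) (*-1/ℕ (q ^ α) {{ℕ.m^n≢0 q α}}) ⟨
  (r * y) * (Q * 1/ q ^ α)                 ≡⟨ ℚ-identity r y Q (1/ q ^ α) ⟩
  (r * 1/ q ^ α) * (y * Q)                 ≡⟨ cong ((r * 1/ q ^ α) *_) (tailVec-shift c q α≤k) ⟩
  (r * 1/ q ^ α) * tailVec c q 0 k         ∎
  where
  open ≡-Reasoning
  y = tailVec c q α k
  Q = ℕ→ℚ (q ^ α)
  ℚ-identity : ∀ r y Q Q⁻¹ → (r * y) * (Q * Q⁻¹) ≡ (r * Q⁻¹) * (y * Q)
  ℚ-identity = solve 4 (λ r y Q Q⁻¹ → (r :* y) :* (Q :* Q⁻¹) := (r :* Q⁻¹) :* (y :* Q)) refl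

module Span (u v : U) where

  span : ℚ → ℚ → U
  span A B = (A ·U u) +U (B ·U v)

  span-0 : span 0ℚ 0ℚ ≈U 0U
  span-0 k = trans (cong₂ _+_ (ℚ.*-zeroˡ (u k)) (ℚ.*-zeroˡ (v k))) (ℚ.+-identityˡ 0ℚ)

  span-0ʳ : ∀ A → (A ·U u) ≈U span A 0ℚ
  span-0ʳ A k = sym (trans (cong (λ w → A * u k + w) (ℚ.*-zeroˡ (v k))) (ℚ.+-identityʳ (A * u k)))

  span-0ˡ : ∀ B → (B ·U v) ≈U span 0ℚ B
  span-0ˡ B k = sym (trans (cong (_+ B * v k) (ℚ.*-zeroˡ (u k))) (ℚ.+-identityˡ (B * v k)))

  span-+ : ∀ A B A′ B′ → (span A B +U span A′ B′) ≈U span (A + A′) (B + B′)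
  span-+ A B A′ B′ k = ℚ-identity A B A′ B′ (u k) (v k)
    where
    ℚ-identity : ∀ A B A′ B′ u v → (A * u + B * v) + (A′ * u + B′ * v) ≡ (A + A′) * u + (B + B′) * v
    ℚ-identity = solve 6 (λ A B A′ B′ u v → (A :* u :+ B :* v) :+ (A′ :* u :+ B′ :* v) := (A :+ A′) :* u :+ (B :+ B′) :* v) refl

  span-neg : ∀ A B → (-U span A B) ≈U span (- A) (- B)
  span-neg A B k = ℚ-identity A B (u k) (v k)
    where
    ℚ-identity : ∀ A B u v → - (A * u + B * v) ≡ (- A) * u + (- B) * v
    ℚ-identity = solve 4 (λ A B u v → :- (A :* u :+ B :* v) := (:- A) :* u :+ (:- B) :* v) refl

  span-⋆ : ∀ m A B → (m ⋆U span A B) ≈U span (ℕ→ℚ m * A) (ℕ→ℚ m * B)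
  span-⋆ m A B k = ℚ-identity (ℕ→ℚ m) A B (u k) (v k)
    where
    ℚ-identity : ∀ m A B u v → m * (A * u + B * v) ≡ (m * A) * u + (m * B) * v
    ℚ-identity = solve 5 (λ m A B u v → m :* (A :* u :+ B :* v) := (m :* A) :* u :+ (m :* B) :* v) refl

  ⋆-tail : ∀ {x g K A B} m → x ≈U (m ⋆U g) → g ≈[ K ] span A B → x ≈[ K ] span (ℕ→ℚ m * A) (ℕ→ℚ m * B)
  ⋆-tail {A = A} {B} m x≈mg g≈AB k K≤k = trans (x≈mg k) (trans (cong (ℕ→ℚ m *_) (g≈AB k K≤k)) (span-⋆ m A B k))

  span-difference≡0 : ∀ A B A′ B′ k → span A B k ≡ span A′ B′ k → span (A - A′) (B - B′) k ≡ 0ℚ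
  span-difference≡0 A B A′ B′ k eq = begin
    (A - A′) * u k + (B - B′) * v k                 ≡⟨ ℚ-identity A B A′ B′ (u k) (v k) ⟩
    (A * u k + B * v k) - (A′ * u k + B′ * v k)     ≡⟨ cong (_- (A′ * u k + B′ * v k)) eq ⟩
    (A′ * u k + B′ * v k) - (A′ * u k + B′ * v k)   ≡⟨ ℚ.+-inverseʳ (A′ * u k + B′ * v k) ⟩
    0ℚ                                              ∎
    where
    open ≡-Reasoning
    ℚ-identity : ∀ A B A′ B′ u v → (A - A′) * u + (B - B′) * v ≡ (A * u + B * v) - (A′ * u + B′ * v)
    ℚ-identity = solve 6 (λ A B A′ B′ u v → (A :- A′) :* u :+ (B :- B′) :* v := (A :* u :+ B :* v) :- (A′ :* u :+ B′ :* v)) refl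

module Independence (u v : U) {q₁ q₂ : ℕ} (1<q₁ : 1 < q₁) (1<q₂ : 1 < q₂)
  (u+v≡1 : ∀ k → u k + v k ≡ 1ℚ)
  (qᵏ∣u : ∀ k → ∃ λ t → u k ≡ ℤ→ℚ (t ℤ.* + (q₁ ^ k)))
  (qᵏ∣v : ∀ k → ∃ λ t → v k ≡ ℤ→ℚ (t ℤ.* + (q₂ ^ k))) where
  open Span u v

  private
    B≡[B-A]u : ∀ A B u v → u + v ≡ 1ℚ → A * u + B * v ≡ 0ℚ → B ≡ (B - A) * u
    B≡[B-A]u A B u v u+v≡1 Au+Bv≡0 = begin
      B                             ≡⟨ ℚ.*-identityʳ B ⟨
      B * 1ℚ                        ≡⟨ cong (B *_) u+v≡1 ⟨
      B * (u + v)                   ≡⟨ ℚ-identity A B u v ⟩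
      (B - A) * u + (A * u + B * v) ≡⟨ cong (λ x → (B - A) * u + x) Au+Bv≡0 ⟩
      (B - A) * u + 0ℚ              ≡⟨ ℚ.+-identityʳ ((B - A) * u) ⟩
      (B - A) * u                   ∎
      where
      open ≡-Reasoning
      ℚ-identity : ∀ A B u v → B * (u + v) ≡ (B - A) * u + (A * u + B * v)
      ℚ-identity = solve 4 (λ A B u v → B :* (u :+ v) := (B :- A) :* u :+ (A :* u :+ B :* v)) refl

  span≈[]0⇒0 : ∀ {K A B} → span A B ≈[ K ] 0U → A ≡ 0ℚ × B ≡ 0ℚ
  span≈[]0⇒0 {K} {A} {B} span≈0 =
    eventually-multiple-of-powers⇒0 {C = A - B} 1<q₂ A-multiple ,
    eventually-multiple-of-powers⇒0 {C = B - A} 1<q₁ B-multiple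
    where
    B-multiple : ∀ k → K ≤ k → ∃ λ t → B ≡ (B - A) * ℤ→ℚ (t ℤ.* + (q₁ ^ k))
    B-multiple k K≤k = proj₁ (qᵏ∣u k) ,
      trans (B≡[B-A]u A B (u k) (v k) (u+v≡1 k) (span≈0 k K≤k)) (cong ((B - A) *_) (proj₂ (qᵏ∣u k)))
    A-multiple : ∀ k → K ≤ k → ∃ λ t → A ≡ (A - B) * ℤ→ℚ (t ℤ.* + (q₂ ^ k))
    A-multiple k K≤k = proj₁ (qᵏ∣v k) ,
      trans (B≡[B-A]u B A (v k) (u k) (trans (ℚ.+-comm (v k) (u k)) (u+v≡1 k))
                                    (trans (ℚ.+-comm (B * v k) (A * u k)) (span≈0 k K≤k)))
            (cong ((A - B) *_) (proj₂ (qᵏ∣v k)))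

  span-injective : ∀ {x K K′ A B A′ B′} → x ≈[ K ] span A B → x ≈[ K′ ] span A′ B′ → A ≡ A′ × B ≡ B′
  span-injective {A = A} {B} {A′} {B′} x≈AB x≈A′B′ =
    map p-q≡0⇒p≡q p-q≡0⇒p≡q (span≈[]0⇒0 λ k K⊔K′≤k →
      span-difference≡0 A B A′ B′ k (≈[]-trans (λ k′ K≤k′ → sym (x≈AB k′ K≤k′)) x≈A′B′ k K⊔K′≤k))

-- Enumerations

-- unpair walks through ℕ × ℕ along the anti-diagonals.
step : ℕ × ℕ → ℕ × ℕ
step (a , zero)  = 0 , suc a
step (a , suc b) = suc a , b

unpair : ℕ → ℕ × ℕ
unpair zero    = 0 , 0
unpair (suc n) = step (unpair n)

private
  along-diagonal : ∀ a b → ∃ (λ n → unpair n ≡ (0 , a ℕ.+ b)) → ∃ λ n → unpair n ≡ (a , b)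
  along-diagonal zero    b start = start
  along-diagonal (suc a) b start with along-diagonal a (suc b) (subst (λ s → ∃ λ n → unpair n ≡ (0 , s)) (sym (ℕ.+-suc a b)) start)
  ... | n , unpair-n≡a,b+1 = suc n , cong step unpair-n≡a,b+1

  diagonal-start : ∀ s → ∃ λ n → unpair n ≡ (0 , s)
  diagonal-start zero = 0 , refl
  diagonal-start (suc s) with along-diagonal s 0 (subst (λ s → ∃ λ n → unpair n ≡ (0 , s)) (sym (ℕ.+-identityʳ s)) (diagonal-start s))
  ... | n , unpair-n≡s,0 = suc n , cong step unpair-n≡s,0

unpair-surjective : ∀ a b → ∃ λ n → unpair n ≡ (a , b)
unpair-surjective a b = along-diagonal a b (diagonal-start (a ℕ.+ b))

_⊗_ : ∀ {A B : Set} → (ℕ → A) → (ℕ → B) → ℕ → A × B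
(f ⊗ g) n = map f g (unpair n)

⊗-at : ∀ {A B : Set} (f : ℕ → A) (g : ℕ → B) {n i j} → unpair n ≡ (i , j) → (f ⊗ g) n ≡ (f i , g j)
⊗-at f g = cong (map f g)

enumℤ : ℕ → ℤ
enumℤ n = uncurry (λ a b → + a ℤ.- + b) (unpair n)

enumℤ-surjective : ∀ z → ∃ λ n → enumℤ n ≡ z
enumℤ-surjective (+ m) with unpair-surjective m 0
... | n , unpair-n≡m,0 = n , trans (cong (uncurry (λ a b → + a ℤ.- + b)) unpair-n≡m,0) (ℤ.+-identityʳ (+ m))
enumℤ-surjective -[1+ m ] with unpair-surjective 0 (suc m)
... | n , unpair-n≡0,m+1 = n , cong (uncurry (λ a b → + a ℤ.- + b)) unpair-n≡0,m+1

enumℚ : ℕ → ℚ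
enumℚ n = uncurry (λ i d → i ℚ./ suc d) ((enumℤ ⊗ id) n)

enumℚ-surjective : ∀ r → ∃ λ n → enumℚ n ≡ r
enumℚ-surjective r@(mkℚ num den-1 _) with enumℤ-surjective num
... | i , enumℤ-i≡num with unpair-surjective i den-1
... | n , unpair-n≡i,den-1 = n , (begin
  enumℚ n                    ≡⟨ cong (uncurry (λ i d → i ℚ./ suc d)) (⊗-at enumℤ id {n} unpair-n≡i,den-1) ⟩
  enumℤ i ℚ./ suc den-1      ≡⟨ cong (ℚ._/ suc den-1) enumℤ-i≡num ⟩
  num ℚ./ suc den-1          ≡⟨ ℚ.↥p/↧p≡p r ⟩
  r                          ∎)
  where open ≡-Reasoning

prefix : ℕ → ℕ → U
prefix zero    n k       = 0U k
prefix (suc K) n zero    = enumℚ (proj₁ (unpair n))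
prefix (suc K) n (suc k) = prefix K (proj₂ (unpair n)) k

prefix-surjective : ∀ K w → w ≈[ K ] 0U → ∃ λ n → prefix K n ≈U w
prefix-surjective zero w w≈0 = 0 , λ k → sym (w≈0 k z≤n)
prefix-surjective (suc K) w w≈0
  with prefix-surjective K (λ k → w (suc k)) (λ k K≤k → w≈0 (suc k) (s≤s K≤k)) | enumℚ-surjective (w 0)
... | n₀ , prefix-n₀≈w∘suc | n₁ , enumℚ-n₁≡w₀ with unpair-surjective n₁ n₀
... | n , unpair-n≡n₁,n₀ = n , prefix-n≈w
  where
  prefix-n≈w : prefix (suc K) n ≈U w
  prefix-n≈w zero    = trans (cong (λ p → enumℚ (proj₁ p)) unpair-n≡n₁,n₀) enumℚ-n₁≡w₀
  prefix-n≈w (suc k) = trans (cong (λ p → prefix K (proj₂ p) k) unpair-n≡n₁,n₀) (prefix-n₀≈w∘suc k)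

finitelySupported : ℕ → U
finitelySupported n = uncurry prefix (unpair n)

finitelySupported-surjective : ∀ K w → w ≈[ K ] 0U → ∃ λ n → finitelySupported n ≈U w
finitelySupported-surjective K w w≈0 with prefix-surjective K w w≈0
... | m , prefix-m≈w with unpair-surjective K m
... | n , unpair-n≡K,m = n , λ k → trans (cong (λ p → uncurry prefix p k) unpair-n≡K,m) (prefix-m≈w k)

module _ (u v : U) where
  open Span u v

  eventuallySpanned-countable :
    AtMostCountable (λ x → ∃ λ K → ∃ λ A → ∃ λ B → x ≈[ K ] span A B)
  eventuallySpanned-countable = decode ∘ (finitelySupported ⊗ (enumℚ ⊗ enumℚ)) , covers
    where
    decode : U × ℚ × ℚ → U
    decode (w , A , B) = w +U span A B
    covers : ∀ x → (∃ λ K → ∃ λ A → ∃ λ B → x ≈[ K ] span A B)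
           → ∃ λ n → decode ((finitelySupported ⊗ (enumℚ ⊗ enumℚ)) n) ≈U x
    covers x (K , A , B , x≈span) with finitelySupported-surjective K (x +U (-U span A B)) x-span≈0
      where
      x-span≈0 : (x +U (-U span A B)) ≈[ K ] 0U
      x-span≈0 k K≤k = trans (cong (λ y → x k - y) (sym (x≈span k K≤k))) (ℚ.+-inverseʳ (x k))
    ... | i , wᵢ≈x-span with enumℚ-surjective A | enumℚ-surjective B
    ... | a , enumℚ-a≡A | b , enumℚ-b≡B with unpair-surjective a b
    ... | j , unpair-j≡a,b with unpair-surjective i j
    ... | n , unpair-n≡i,j = n , λ k → begin
      decode ((finitelySupported ⊗ (enumℚ ⊗ enumℚ)) n) k
        ≡⟨ cong (λ t → decode t k) (⊗-at finitelySupported (enumℚ ⊗ enumℚ) {n} unpair-n≡i,j) ⟩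
      decode (finitelySupported i , (enumℚ ⊗ enumℚ) j) k
        ≡⟨ cong (λ t → decode (finitelySupported i , t) k) (⊗-at enumℚ enumℚ {j} unpair-j≡a,b) ⟩
      finitelySupported i k + span (enumℚ a) (enumℚ b) k
        ≡⟨ cong₂ (λ A B → finitelySupported i k + span A B k) enumℚ-a≡A enumℚ-b≡B ⟩
      finitelySupported i k + span A B k
        ≡⟨ cong (_+ span A B k) (wᵢ≈x-span k) ⟩
      (x k - span A B k) + span A B k
        ≡⟨ p≡p-q+q (x k) (span A B k) ⟨
      x k ∎
      where open ≡-Reasoning

-- The groups M and N

module DirectSum (p₁ p₂ : ℕ) .{{_ : NonZero p₁}} .{{_ : NonZero p₂}} where

  M : Subset
  M = Mset p₁ p₂

  ℤ[1/p₁,1/p₂]-valued : U → Set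
  ℤ[1/p₁,1/p₂]-valued x = ∀ k → (ProductOfPowers p₁ p₂ ⁻¹ℤ) (x k)

  M⇒ℤ[1/p₁,1/p₂]-valued : ∀ {x} → M x → ℤ[1/p₁,1/p₂]-valued x
  M⇒ℤ[1/p₁,1/p₂]-valued {x} (x∈ , _) k = ℤ[1/p₁,1/p₂]⇒⁻¹ℤ (x k) (x∈ k)

  M-intro : ∀ {x K} → ℤ[1/p₁,1/p₂]-valued x → x ≈[ K ] 0U → M x
  M-intro {K = K} x∈ x≈0 = (λ k → ⁻¹ℤ⇒ℤ[1/p₁,1/p₂] (x∈ k)) , K , x≈0

  private
    closed = productOfPowers-closed p₁ p₂

  M-≈ : ∀ x y → x ≈U y → M x → M y
  M-≈ x y x≈y x∈M@(_ , K , x≈0) = M-intro {K = K}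
    (λ k → subst (ProductOfPowers p₁ p₂ ⁻¹ℤ) (x≈y k) (M⇒ℤ[1/p₁,1/p₂]-valued x∈M k))
    (λ k K≤k → trans (sym (x≈y k)) (x≈0 k K≤k))

  M-0 : M 0U
  M-0 = M-intro {K = 0} (λ k → ⁻¹ℤ-ℤ closed (+ 0)) (λ k _ → refl)

  M-+ : ∀ x y → M x → M y → M (x +U y)
  M-+ x y x∈M@(_ , K , x≈0) y∈M@(_ , K′ , y≈0) = M-intro {K = K ⊔ K′}
    (λ k → ⁻¹ℤ-+ closed (M⇒ℤ[1/p₁,1/p₂]-valued x∈M k) (M⇒ℤ[1/p₁,1/p₂]-valued y∈M k))
    (λ k K⊔K′≤k → trans (≈[]-+ x≈0 y≈0 k K⊔K′≤k) (ℚ.+-identityˡ 0ℚ))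

  M-neg : ∀ x → M x → M (-U x)
  M-neg x x∈M@(_ , K , x≈0) = M-intro {K = K}
    (λ k → ⁻¹ℤ-neg closed (M⇒ℤ[1/p₁,1/p₂]-valued x∈M k))
    (λ k K≤k → cong -_ (x≈0 k K≤k))

  M-isSubgroup : IsSubgroup M
  M-isSubgroup = M-≈ , M-0 , M-+ , M-neg

  M-divisible : ∀ {m} .{{_ : NonZero m}} → ProductOfPowers p₁ p₂ m
              → ∀ {x} → M x → ∃ λ g → M g × x ≈U (m ⋆U g)
  M-divisible {m} m∈ {x} x∈M@(_ , K , x≈0) =
    1/ℕ m ·U x ,
    M-intro {K = K} (λ k → ⁻¹ℤ-* closed (⁻¹ℤ-1/ℕ closed m∈) (M⇒ℤ[1/p₁,1/p₂]-valued x∈M k))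
      (λ k K≤k → trans (cong (1/ℕ m *_) (x≈0 k K≤k)) (ℚ.*-zeroʳ (1/ℕ m))) ,
    λ k → sym (*-1/ℕ-cancelˡ m (x k))

  M⊆p₁^ωM : M ⊆ (p₁ ^ω· M)
  M⊆p₁^ωM x x∈M n = M-divisible {p₁ ^ n} {{ℕ.m^n≢0 p₁ n}} (n , 0 , ℕ.*-identityʳ (p₁ ^ n)) x∈M

  M⊆p₂^ωM : M ⊆ (p₂ ^ω· M)
  M⊆p₂^ωM x x∈M n = M-divisible {p₂ ^ n} {{ℕ.m^n≢0 p₂ n}} (0 , n , ℕ.*-identityˡ (p₂ ^ n)) x∈M

module Construction (p₁ p₂ q₁ q₂ : ℕ)
  (p₁-prime : Prime p₁) (p₂-prime : Prime p₂) (q₁-prime : Prime q₁) (q₂-prime : Prime q₂)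
  (p₁≢p₂ : p₁ ≢ p₂) (p₁≢q₁ : p₁ ≢ q₁) (p₁≢q₂ : p₁ ≢ q₂)
  (c d : ℕ → ℤ) (bezout : ∀ α → (c α ℤ.* (+ q₁) ℤ.^ α) ℤ.+ (d α ℤ.* (+ q₂) ℤ.^ α) ≡ + 1) where

  open DirectSum p₁ p₂ {{prime⇒nonZero p₁-prime}} {{prime⇒nonZero p₂-prime}} public

  N : Subset
  N = Nset p₁ p₂ q₁ q₂ c d

  N-isSubgroup : IsSubgroup N
  N-isSubgroup = n-≈ , n-0 , n-+ , n-neg

  N-minimal : ∀ {G : Subset} → IsSubgroup G → M ⊆ G
            → (∀ α r → InZ[1/p] p₂ r → G (r ·U yv q₁ c α))
            → (∀ α s → InZ[1/p] p₂ s → G (s ·U zv q₂ d α))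
            → N ⊆ G
  N-minimal {G} (G-≈ , 0∈G , G-+ , G-neg) M⊆G y∈G z∈G = go
    where
    go : N ⊆ G
    go x (n-M x x∈M) = M⊆G x x∈M
    go _ (n-y α r r∈) = y∈G α r r∈
    go _ (n-z α s s∈) = z∈G α s s∈
    go _ n-0 = 0∈G
    go _ (n-+ x y x∈N y∈N) = G-+ x y (go x x∈N) (go y y∈N)
    go _ (n-neg x x∈N) = G-neg x (go x x∈N)
    go y (n-≈ x y x≈y x∈N) = G-≈ x y x≈y (go x x∈N)

  M⊆N : M ⊆ N
  M⊆N = n-M

  instance
    _ = prime⇒nonZero q₁-prime
    _ = prime⇒nonZero q₂-prime

  N⊆p₂ⁿN : ∀ n → N ⊆ (p₂ ^[ n ]· N)
  N⊆p₂ⁿN n = N-minimal (^[]·-isSubgroup p₂ n N-isSubgroup) M⊆p₂ⁿN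
    (λ α r r∈ → _ , n-y α (1/ℕ (p₂ ^ n) * r) (p₂ⁿ-divides r r∈) , ·U-⋆U-1/ℕ (p₂ ^ n) r (yv q₁ c α))
    (λ α s s∈ → _ , n-z α (1/ℕ (p₂ ^ n) * s) (p₂ⁿ-divides s s∈) , ·U-⋆U-1/ℕ (p₂ ^ n) s (zv q₂ d α))
    where
    instance _ = ℕ.m^n≢0 p₂ n {{prime⇒nonZero p₂-prime}}
    M⊆p₂ⁿN : M ⊆ (p₂ ^[ n ]· N)
    M⊆p₂ⁿN x x∈M = ^ω·-mono p₂ M⊆N x (M⊆p₂^ωM x x∈M) n
    p₂ⁿ-divides : ∀ r → InZ[1/p] p₂ r → InZ[1/p] p₂ (1/ℕ (p₂ ^ n) * r)
    p₂ⁿ-divides r r∈ = ⁻¹ℤ⇒ℤ[1/p] (⁻¹ℤ-* (powerOf-closed p₂) (⁻¹ℤ-1/ℕ (powerOf-closed p₂) (n , refl)) (ℤ[1/p]⇒⁻¹ℤ r r∈))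

  N-coordinates : N ⊆ ℤ[1/p₁,1/p₂]-valued
  N-coordinates = N-minimal (⁻¹ℤ-coordinatewise-isSubgroup (productOfPowers-closed p₁ p₂))
    (λ x → M⇒ℤ[1/p₁,1/p₂]-valued)
    (λ α r r∈ k → generator-coordinate r r∈ (tailVec-integral c q₁ α k))
    (λ α s s∈ k → generator-coordinate s s∈ (tailVec-integral d q₂ α k))
    where
    generator-coordinate : ∀ r {w} → InZ[1/p] p₂ r → ∃ (λ t → w ≡ ℤ→ℚ t) → (ProductOfPowers p₁ p₂ ⁻¹ℤ) (r * w)
    generator-coordinate r r∈ (t , refl) = ⁻¹ℤ-* (productOfPowers-closed p₁ p₂)
      (⁻¹ℤ-mono (λ { (j , refl) → 0 , j , ℕ.*-identityˡ (p₂ ^ j) }) (ℤ[1/p]⇒⁻¹ℤ r r∈))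
      (⁻¹ℤ-ℤ (productOfPowers-closed p₁ p₂) t)

  M≤pN : M ≤p N
  M≤pN = M⊆N , pure
    where
    pure : ∀ n x → M x → (∃ λ h → N h × x ≈U (n ⋆U h)) → ∃ λ h → M h × x ≈U (n ⋆U h)
    pure n x (_ , K , x≈0) (h , h∈N , x≈nh) with n ℕ.≟ 0
    ... | yes refl = 0U , M-0 , λ k → trans (x≈nh k) (trans (ℚ.*-zeroˡ (h k)) (sym (ℚ.*-zeroˡ 0ℚ)))
    ... | no n≢0 = h , h∈M , x≈nh
      where
      h∈M : M h
      h∈M = M-intro {K = K} (N-coordinates h h∈N)
        (λ k K≤k → ℕ→ℚ-*≡0⇒≡0 n≢0 (trans (sym (x≈nh k)) (x≈0 k K≤k)))

  u v : U
  u = yv q₁ c 0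
  v = zv q₂ d 0

  u+v≡1 : ∀ k → u k + v k ≡ 1ℚ
  u+v≡1 k = begin
    ℤ→ℚ (c k ℤ.* + (q₁ ^ k)) + ℤ→ℚ (d k ℤ.* + (q₂ ^ k))   ≡⟨ ℤ→ℚ-+ (c k ℤ.* + (q₁ ^ k)) (d k ℤ.* + (q₂ ^ k)) ⟨
    ℤ→ℚ (c k ℤ.* + (q₁ ^ k) ℤ.+ d k ℤ.* + (q₂ ^ k))       ≡⟨ cong₂ (λ a b → ℤ→ℚ (c k ℤ.* a ℤ.+ d k ℤ.* b)) (+-^ q₁ k) (+-^ q₂ k) ⟩
    ℤ→ℚ (c k ℤ.* (+ q₁) ℤ.^ k ℤ.+ d k ℤ.* (+ q₂) ℤ.^ k)   ≡⟨ cong ℤ→ℚ (bezout k) ⟩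
    1ℚ                                                   ∎
    where open ≡-Reasoning

  open Span u v
  open Independence u v (ℕ.nonTrivial⇒n>1 q₁ {{prime⇒nonTrivial q₁-prime}})
    (ℕ.nonTrivial⇒n>1 q₂ {{prime⇒nonTrivial q₂-prime}}) u+v≡1 (λ k → c k , refl) (λ k → d k , refl)

  generators-tail : ∀ α r s → ((r ·U yv q₁ c α) +U (s ·U zv q₂ d α)) ≈[ α ] span (r * 1/ q₁ ^ α) (s * 1/ q₂ ^ α)
  generators-tail α r s k α≤k = cong₂ _+_ (*-tailVec-shift c q₁ r α≤k) (*-tailVec-shift d q₂ s α≤k)

  record IntegralTail (x : U) : Set where
    constructor integralTail
    field
      start : ℕ
      A B : ℚ
      A-integral : ℤ₍ p₁ ₎ A
      B-integral : ℤ₍ p₁ ₎ B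
      tail : x ≈[ start ] span A B

  private
    ℤ₍p₁₎-closed = primeTo-closed p₁-prime
    0∈ℤ₍p₁₎ = ⁻¹ℤ-ℤ ℤ₍p₁₎-closed (+ 0)

  integralTail-isSubgroup : IsSubgroup IntegralTail
  integralTail-isSubgroup = ≈-closed , integralTail 0 0ℚ 0ℚ 0∈ℤ₍p₁₎ 0∈ℤ₍p₁₎ (λ k _ → sym (span-0 k)) , +-closed , neg-closed
    where
    ≈-closed : ∀ x y → x ≈U y → IntegralTail x → IntegralTail y
    ≈-closed x y x≈y (integralTail K A B A∈ B∈ x≈AB) =
      integralTail K A B A∈ B∈ λ k K≤k → trans (sym (x≈y k)) (x≈AB k K≤k)
    +-closed : ∀ x y → IntegralTail x → IntegralTail y → IntegralTail (x +U y)
    +-closed x y (integralTail K A B A∈ B∈ x≈AB) (integralTail K′ A′ B′ A′∈ B′∈ y≈A′B′) =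
      integralTail (K ⊔ K′) (A + A′) (B + B′) (⁻¹ℤ-+ ℤ₍p₁₎-closed A∈ A′∈) (⁻¹ℤ-+ ℤ₍p₁₎-closed B∈ B′∈)
        λ k K⊔K′≤k → trans (≈[]-+ x≈AB y≈A′B′ k K⊔K′≤k) (span-+ A B A′ B′ k)
    neg-closed : ∀ x → IntegralTail x → IntegralTail (-U x)
    neg-closed x (integralTail K A B A∈ B∈ x≈AB) =
      integralTail K (- A) (- B) (⁻¹ℤ-neg ℤ₍p₁₎-closed A∈) (⁻¹ℤ-neg ℤ₍p₁₎-closed B∈)
        λ k K≤k → trans (cong -_ (x≈AB k K≤k)) (span-neg A B k)

  N-tail : N ⊆ IntegralTail
  N-tail = N-minimal integralTail-isSubgroup
    (λ x x∈M → integralTail (proj₁ (proj₂ x∈M)) 0ℚ 0ℚ 0∈ℤ₍p₁₎ 0∈ℤ₍p₁₎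
                 λ k K≤k → trans (proj₂ (proj₂ x∈M) k K≤k) (sym (span-0 k)))
    (λ α r r∈ → integralTail α (r * 1/ q₁ ^ α) 0ℚ (coefficient q₁-prime p₁≢q₁ r r∈ α) 0∈ℤ₍p₁₎
                 λ k α≤k → trans (*-tailVec-shift c q₁ r α≤k) (span-0ʳ (r * 1/ q₁ ^ α) k))
    (λ α s s∈ → integralTail α 0ℚ (s * 1/ q₂ ^ α) 0∈ℤ₍p₁₎ (coefficient q₂-prime p₁≢q₂ s s∈ α)
                 λ k α≤k → trans (*-tailVec-shift d q₂ s α≤k) (span-0ˡ (s * 1/ q₂ ^ α) k))
    where
    p₁∤p₂ⁱ : ∀ {m} → PowerOf p₂ m → ¬ p₁ ∣ m
    p₁∤p₂ⁱ (i , refl) = prime-∤-^ p₁-prime (prime-∤-prime p₁-prime p₂-prime p₁≢p₂) i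
    coefficient : ∀ {q} → Prime q → p₁ ≢ q → ∀ r → InZ[1/p] p₂ r
                → ∀ α .{{_ : NonZero q}} → ℤ₍ p₁ ₎ (r * 1/ q ^ α)
    coefficient {q} q-prime p₁≢q r r∈ α = ⁻¹ℤ-* ℤ₍p₁₎-closed (⁻¹ℤ-mono p₁∤p₂ⁱ (ℤ[1/p]⇒⁻¹ℤ r r∈))
      (⁻¹ℤ-1/ℕ ℤ₍p₁₎-closed {{ℕ.m^n≢0 q α}} (prime-∤-^ p₁-prime (prime-∤-prime p₁-prime q-prime p₁≢q) α))

  p₁^ωN-tail-divisible : ∀ {x K} A B → (p₁ ^ω· N) x → x ≈[ K ] span A B → ∀ n
                       → pⁿℤ₍p₎ p₁ n A × pⁿℤ₍p₎ p₁ n B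
  p₁^ωN-tail-divisible {x} A B x∈p₁ᵚN x≈AB n = divide (x∈p₁ᵚN n)
    where
    divide : (p₁ ^[ n ]· N) x → pⁿℤ₍p₎ p₁ n A × pⁿℤ₍p₎ p₁ n B
    divide (g , g∈N , x≈pⁿg) = rescale (N-tail g g∈N)
      where
      rescale : IntegralTail g → pⁿℤ₍p₎ p₁ n A × pⁿℤ₍p₎ p₁ n B
      rescale (integralTail K′ A′ B′ A′∈ B′∈ g≈A′B′) =
        (A′ , A′∈ , proj₁ A,B≡pⁿA′,pⁿB′) , (B′ , B′∈ , proj₂ A,B≡pⁿA′,pⁿB′)
        where
        A,B≡pⁿA′,pⁿB′ : A ≡ ℕ→ℚ (p₁ ^ n) * A′ × B ≡ ℕ→ℚ (p₁ ^ n) * B′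
        A,B≡pⁿA′,pⁿB′ = span-injective x≈AB (⋆-tail (p₁ ^ n) x≈pⁿg g≈A′B′)

  p₁^ωN-tail-vanishes : ∀ {x K} A B → (p₁ ^ω· N) x → x ≈[ K ] span A B → A ≡ 0ℚ × B ≡ 0ℚ
  p₁^ωN-tail-vanishes A B x∈p₁ᵚN x≈AB =
    ⋂pⁿℤ₍p₎≡0 p₁-prime (λ n → proj₁ (p₁^ωN-tail-divisible A B x∈p₁ᵚN x≈AB n)) ,
    ⋂pⁿℤ₍p₎≡0 p₁-prime (λ n → proj₂ (p₁^ωN-tail-divisible A B x∈p₁ᵚN x≈AB n))

  p₁^ωN⊆M : (p₁ ^ω· N) ⊆ M
  p₁^ωN⊆M x x∈p₁ᵚN = vanishing-tail (N-tail x x∈N)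
    where
    x∈N = ^ω·-⊆ p₁ n-≈ x x∈p₁ᵚN
    vanishing-tail : IntegralTail x → M x
    vanishing-tail (integralTail K A B _ _ x≈AB) = M-intro {K = K} (N-coordinates x x∈N) λ k K≤k → begin
      x k                 ≡⟨ x≈AB k K≤k ⟩
      span A B k          ≡⟨ cong₂ (λ A B → span A B k) (proj₁ A,B≡0) (proj₂ A,B≡0) ⟩
      span 0ℚ 0ℚ k        ≡⟨ span-0 k ⟩
      0ℚ                  ∎
      where
      open ≡-Reasoning
      A,B≡0 : A ≡ 0ℚ × B ≡ 0ℚ
      A,B≡0 = p₁^ωN-tail-vanishes A B x∈p₁ᵚN x≈AB

  N-countable : AtMostCountable N
  N-countable = atMostCountable-⊆ (λ x x∈N → eventuallySpanned (N-tail x x∈N)) (eventuallySpanned-countable u v)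
    where
    eventuallySpanned : ∀ {x} → IntegralTail x → ∃ λ K → ∃ λ A → ∃ λ B → x ≈[ K ] span A B
    eventuallySpanned (integralTail K A B _ _ x≈AB) = K , A , B , x≈AB

  generators-independent : ∀ α r s → (p₁ ^ω· N) ((r ·U yv q₁ c α) +U (s ·U zv q₂ d α)) → r ≡ 0ℚ × s ≡ 0ℚ
  generators-independent α r s x∈p₁ᵚN =
    map (*-1/ℕ≡0⇒≡0 (q₁ ^ α) {{ℕ.m^n≢0 q₁ α}}) (*-1/ℕ≡0⇒≡0 (q₂ ^ α) {{ℕ.m^n≢0 q₂ α}})
      (p₁^ωN-tail-vanishes (r * 1/ q₁ ^ α) (s * 1/ q₂ ^ α) x∈p₁ᵚN (generators-tail α r s))

  p₁^ωM≐M : (p₁ ^ω· M) ≐ M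
  p₁^ωM≐M = ^ω·-⊆ p₁ M-≈ , M⊆p₁^ωM

  p₂^ωN≐N : (p₂ ^ω· N) ≐ N
  p₂^ωN≐N = ^ω·-⊆ p₂ n-≈ , λ x x∈N n → N⊆p₂ⁿN n x x∈N

  p₁^ωN≐M : (p₁ ^ω· N) ≐ M
  p₁^ωN≐M = p₁^ωN⊆M , λ x x∈M → ^ω·-mono p₁ M⊆N x (M⊆p₁^ωM x x∈M)

  M∈K₁ : K₁ p₁ p₂ M
  M∈K₁ = M-isSubgroup , torsionFree M ,
    atMostCountable-⊆ (λ x x∈ → M⊆N x (^ω·-⊆ p₁ M-≈ x x∈)) N-countable ,
    atMostCountable-⊆ (λ x x∈ → M⊆N x (^ω·-⊆ p₂ M-≈ x x∈)) N-countable

  N∈K₁ : K₁ p₁ p₂ N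
  N∈K₁ = N-isSubgroup , torsionFree N ,
    atMostCountable-⊆ (^ω·-⊆ p₁ n-≈) N-countable , atMostCountable-⊆ (^ω·-⊆ p₂ n-≈) N-countable

  M≤K₁N : ≤K₁ p₁ p₂ M N
  M≤K₁N = M≤pN , ≐-trans p₁^ωM≐M (≐-sym p₁^ωN≐M) , inj₁ (≐-sym p₁^ωM≐M)

proposition3p11 : (p₁ p₂ q₁ q₂ : ℕ) → Prime p₁ → Prime p₂ → Prime q₁ → Prime q₂
    → ¬ (p₁ ≡ p₂) → ¬ (p₁ ≡ q₁) → ¬ (p₁ ≡ q₂)
    → ¬ (p₂ ≡ q₁) → ¬ (p₂ ≡ q₂) → ¬ (q₁ ≡ q₂)
    → (c d : ℕ → ℤ)
    → (∀ α → (c α ℤ.* (+ q₁) ℤ.^ α) ℤ.+ (d α ℤ.* (+ q₂) ℤ.^ α) ≡ + 1)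
    → ((α : ℕ) (r s : ℚ) → InZ[1/p] p₂ r → InZ[1/p] p₂ s
         → (p₁ ^ω· Nset p₁ p₂ q₁ q₂ c d) ((r ·U yv q₁ c α) +U (s ·U zv q₂ d α))
         → (r ≡ 0ℚ) × (s ≡ 0ℚ))
      × (((p₁ ^ω· Mset p₁ p₂) ≐ Mset p₁ p₂)
         × ((p₂ ^ω· Nset p₁ p₂ q₁ q₂ c d) ≐ Nset p₁ p₂ q₁ q₂ c d)
         × ((p₁ ^ω· Nset p₁ p₂ q₁ q₂ c d) ≐ Mset p₁ p₂))
      × (K₁ p₁ p₂ (Mset p₁ p₂)
         × K₁ p₁ p₂ (Nset p₁ p₂ q₁ q₂ c d)
         × ≤K₁ p₁ p₂ (Mset p₁ p₂) (Nset p₁ p₂ q₁ q₂ c d))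
-- Part (1) holds for all rationals r, s, and p₂, q₁, q₂ need not be distinct from each other.
proposition3p11 p₁ p₂ q₁ q₂ p₁-prime p₂-prime q₁-prime q₂-prime p₁≢p₂ p₁≢q₁ p₁≢q₂ _ _ _ c d bezout =
  (λ α r s _ _ → generators-independent α r s) ,
  (p₁^ωM≐M , p₂^ωN≐N , p₁^ωN≐M) ,
  (M∈K₁ , N∈K₁ , M≤K₁N)
  where
  open Construction p₁ p₂ q₁ q₂ p₁-prime p₂-prime q₁-prime q₂-prime p₁≢p₂ p₁≢q₁ p₁≢q₂ c d bezout
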